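{- Let $w \in W$ be a strong minuscule element and let $w = s_{i_1}\cdots s_{i_r}$ be any reduced expression of $w$. Then for each $i \in I$ we have $\#\{1 \le p \le r \mid i_p = i\} \ge 1$; that is, every simple reflection $s_i$, $i\in I$, appears at least once in every reduced expression of $w$.
   Context: Let $\mathfrak g$ be a finite-dimensional simple Lie algebra over $\mathbb C$ of type $A_n$, $B_n$, $C_n$ or $D_n$, with index set $I=\{1,\dots,n\}$, simple roots $\alpha_i$, simple coroots $\alpha_i^\vee$, pairing $\langle\cdot,\cdot\rangle$ between weights and coweights, fundamental weights $\Lambda_i$ ($i\in I$), integral weight lattice $P=\bigoplus_{i\in I}\mathbb Z\Lambda_i$, dominant integral weights $P^+=\sum_{i\in I}\mathbb Z_{\ge0}\Lambda_i$, Weyl group $W$ generated by the simple reflections $s_i$, and length function $\ell$. For $\Lambda\in P$, an element $w\in W$ is called $\Lambda$-minuscule if there is a reduced expression $w=s_{i_1}\cdots s_{i_r}$ with $\langle s_{i_{p+1}}\cdots s_{i_r}(\Lambda),\alpha_{i_p}^\vee\rangle=1$ for all $1\le p\le r$ (this condition then holds for every reduced expression). $w$ is dominant minuscule if it is $\Lambda$-minuscule for some $\Lambda\in P^+$. A dominant minuscule element $w$ is called strong minuscule if there is a unique $\Lambda\in P^+$ (denoted $\Lambda_w$) such that $w$ is $\Lambda$-minuscule. -}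

module Defs where

open import Data.Nat as ℕ using (ℕ; zero; suc; _≤_; _≡ᵇ_)
open import Data.Integer as ℤ using (ℤ; +_; -[1+_]; _-_; _*_)
open import Data.Fin using (Fin; toℕ)
open import Data.Bool using (Bool; true; false; if_then_else_; _∧_; _∨_; not)
open import Data.List using (List; []; _∷_; length)
open import Data.Product using (Σ; _×_; ∃)
open import Data.Unit using (⊤)
open import Relation.Binary.PropositionalEquality using (_≡_)

data CartanType : Set where
  A B C D : CartanType

ValidRank : CartanType → ℕ → Set
ValidRank A n = 1 ≤ n
ValidRank B n = 2 ≤ n
ValidRank C n = 2 ≤ n
ValidRank D n = 4 ≤ n

pairIs : ℕ → ℕ → ℕ → ℕ → Bool
pairIs i j a b = ((i ≡ᵇ a) ∧ (j ≡ᵇ b)) ∨ ((i ≡ᵇ b) ∧ (j ≡ᵇ a))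

adjChain : ℕ → ℕ → Bool
adjChain i j = (suc i ≡ᵇ j) ∨ (suc j ≡ᵇ i)

-- Cartan matrix entry a_{ij} = ⟨α_i^∨ , α_j⟩, indices 1-based, rank n
-- (Bourbaki/Kac numbering: in B_n, α_n is short; in C_n, α_n is long;
--  in D_n, the node n-2 is the branch node joined to n-1 and n).
cartanℕ : CartanType → ℕ → ℕ → ℕ → ℤ
cartanℕ A n i j =
  if i ≡ᵇ j then + 2 else if adjChain i j then -[1+ 0 ] else + 0
cartanℕ B n i j =
  if i ≡ᵇ j then + 2
  else if (i ≡ᵇ n) ∧ (suc j ≡ᵇ n) then -[1+ 1 ]
  else if adjChain i j then -[1+ 0 ] else + 0
cartanℕ C n i j =
  if i ≡ᵇ j then + 2
  else if (suc i ≡ᵇ n) ∧ (j ≡ᵇ n) then -[1+ 1 ]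
  else if adjChain i j then -[1+ 0 ] else + 0
cartanℕ D n i j =
  if i ≡ᵇ j then + 2
  else if pairIs i j (n ℕ.∸ 1) n then + 0
  else if pairIs i j (n ℕ.∸ 2) n then -[1+ 0 ]
  else if adjChain i j then -[1+ 0 ] else + 0

-- index set I = Fin n, where k : Fin n stands for the index toℕ k + 1
cartan : (t : CartanType) (n : ℕ) → Fin n → Fin n → ℤ
cartan t n i j = cartanℕ t n (suc (toℕ i)) (suc (toℕ j))

-- Integral weights, in coordinates w.r.t. fundamental weights:
-- μ i = ⟨μ , α_i^∨⟩, so μ = Σ_i (μ i) Λ_i.
Weight : ℕ → Set
Weight n = Fin n → ℤ

Dominant : ∀ {n} → Weight n → Set
Dominant {n} μ = (i : Fin n) → + 0 ℤ.≤ μ i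

-- simple reflection s_j λ = λ - ⟨λ, α_j^∨⟩ α_j ; (α_j) i = a_{ij}
sRefl : (t : CartanType) (n : ℕ) → Fin n → Weight n → Weight n
sRefl t n j μ i = μ i - μ j * cartan t n i j

-- words in the simple reflections; the word i₁ ∷ … ∷ i_r ∷ [] denotes s_{i₁} ⋯ s_{i_r}
Word : ℕ → Set
Word n = List (Fin n)

act : (t : CartanType) (n : ℕ) → Word n → Weight n → Weight n
act t n [] μ = μ
act t n (i ∷ w) μ = sRefl t n i (act t n w μ)

-- two words represent the same Weyl group element (W acts faithfully on P)
SameElt : (t : CartanType) (n : ℕ) → Word n → Word n → Set
SameElt t n u v = (μ : Weight n) (i : Fin n) → act t n u μ i ≡ act t n v μ i

Reduced : (t : CartanType) (n : ℕ) → Word n → Set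
Reduced t n v = (u : Word n) → SameElt t n u v → length v ≤ length u

ReducedExpr : (t : CartanType) (n : ℕ) → Word n → Word n → Set
ReducedExpr t n v w = Reduced t n v × SameElt t n v w

MinWord : (t : CartanType) (n : ℕ) → Weight n → Word n → Set
MinWord t n Λ [] = ⊤
MinWord t n Λ (i ∷ v) = (act t n v Λ i ≡ + 1) × MinWord t n Λ v

IsMinuscule : (t : CartanType) (n : ℕ) → Weight n → Word n → Set
IsMinuscule t n Λ w = Σ (Word n) (λ v → ReducedExpr t n v w × MinWord t n Λ v)

DominantMinuscule : (t : CartanType) (n : ℕ) → Word n → Set
DominantMinuscule t n w = Σ (Weight n) (λ Λ → Dominant Λ × IsMinuscule t n Λ w)

StrongMinuscule : (t : CartanType) (n : ℕ) → Word n → Set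
StrongMinuscule t n w =
  Σ (Weight n) (λ Λ → (Dominant Λ × IsMinuscule t n Λ w) ×
     ((Λ′ : Weight n) → Dominant Λ′ → IsMinuscule t n Λ′ w →
        (i : Fin n) → Λ′ i ≡ Λ i))

-- Fix i and let ϖ be a positive multiple of the fundamental coweight ϖᵢ^∨: pairing with ϖ
-- kills every simple root except αᵢ, on which it is positive. Let w be Λ-minuscule along the
-- word v₀, and suppose some word v for w avoids i. Every letter of v moves a weight by a
-- multiple of a simple root other than αᵢ, so ⟨wΛ, ϖ⟩ = ⟨Λ, ϖ⟩; every letter of v₀ subtracts
-- exactly one simple root, so ⟨Λ, ϖ⟩ − ⟨wΛ, ϖ⟩ is ⟨αᵢ, ϖ⟩ times the number of occurrences of
-- i in v₀. Hence i does not occur in v₀ either. But then v₀ fixes Λᵢ, so w is also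
-- (Λ + Λᵢ)-minuscule, against the uniqueness of Λ. For the classical types ϖ is written down
-- explicitly in the basis of simple coroots.
module Submission where

open import Defs
open import Data.Nat as ℕ using (ℕ; zero; suc; _≡ᵇ_; _⊓_; z≤n; s≤s)
import Data.Nat.Properties as ℕP
open import Data.Integer as ℤ using (ℤ; +_; -_; -1ℤ; _+_; _-_; _*_)
import Data.Integer.Properties as ℤP
open import Data.Integer.Tactic.RingSolver using (solve-∀)
open import Data.Fin as Fin using (Fin; toℕ)
import Data.Fin.Properties as FinP
open import Data.Bool using (true; false; if_then_else_)
open import Data.Bool.Properties using (∧-zeroʳ)
open import Data.List using (List; []; _∷_; _++_)
open import Data.List.Relation.Unary.All as All using (All; []; _∷_)
open import Data.List.Relation.Unary.All.Properties using (¬Any⇒All¬)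
open import Data.List.Relation.Unary.Any using (here; there)
open import Data.List.Membership.Propositional using (_∈_; _∉_)
open import Data.Product using (_×_; _,_; proj₂; ∃-syntax)
open import Data.Sum using (inj₁; inj₂)
open import Data.Unit using (tt)
open import Function using (_∘′_; case_of_)
open import Relation.Nullary using (yes; no; contradiction)
open import Relation.Nullary.Decidable using (decidable-stable; dec-true; dec-false)
open import Relation.Binary.PropositionalEquality
open import Algebra.Properties.Semiring.Sum ℤP.+-*-semiring
  using (sum; sum-cong-≗; sum-replicate-zero; ∑-distrib-+; *-distribˡ-sum)

-- Coweights, minuscule words and the support of a strong minuscule element

module _ {t : CartanType} {n : ℕ} where

  open import Data.List.Membership.DecPropositional (Fin._≟_ {n}) using (_∈?_)

  infix 7 _·_

  _·_ : (Fin n → ℤ) → Weight n → ℤ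
  ϖ · μ = sum (λ j → ϖ j * μ j)

  simpleRoot : Fin n → Weight n
  simpleRoot k j = cartan t n j k

  ·-sRefl : ∀ ϖ k μ → ϖ · sRefl t n k μ ≡ ϖ · μ - μ k * (ϖ · simpleRoot k)
  ·-sRefl ϖ k μ = begin
      sum (λ j → ϖ j * (μ j - μ k * simpleRoot k j))
    ≡⟨ sum-cong-≗ (λ j → expand (ϖ j) (μ j) (μ k) (simpleRoot k j)) ⟩
      sum (λ j → ϖ j * μ j + - μ k * (ϖ j * simpleRoot k j))
    ≡⟨ ∑-distrib-+ (λ j → ϖ j * μ j) (λ j → - μ k * (ϖ j * simpleRoot k j)) ⟩
      ϖ · μ + sum (λ j → - μ k * (ϖ j * simpleRoot k j))
    ≡⟨ cong (λ x → ϖ · μ + x) (sym (*-distribˡ-sum (- μ k) (λ j → ϖ j * simpleRoot k j))) ⟩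
      ϖ · μ + - μ k * (ϖ · simpleRoot k)
    ≡⟨ cong (λ x → ϖ · μ + x) (sym (ℤP.neg-distribˡ-* (μ k) _)) ⟩
      ϖ · μ - μ k * (ϖ · simpleRoot k) ∎
    where
    open ≡-Reasoning
    expand : ∀ w x c a → w * (x - c * a) ≡ w * x + - c * (w * a)
    expand = solve-∀

  -- coeff lists the coordinates of a positive multiple of ϖᵢ^∨ in the basis of simple coroots,
  -- so that coeff · μ is its pairing with the weight μ.
  record FundamentalCoweight (i : Fin n) : Set where
    field
      coeff : Fin n → ℤ
      orthogonal : ∀ k → k ≢ i → coeff · simpleRoot k ≡ + 0
      positive : + 0 ℤ.< coeff · simpleRoot i

  module _ {i : Fin n} (ϖ : FundamentalCoweight i) where
    open FundamentalCoweight ϖ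

    ·-act-∉ : ∀ u μ → i ∉ u → coeff · act t n u μ ≡ coeff · μ
    ·-act-∉ [] μ _ = refl
    ·-act-∉ (k ∷ u) μ i∉k∷u = begin
        coeff · sRefl t n k (act t n u μ)
      ≡⟨ ·-sRefl coeff k (act t n u μ) ⟩
        coeff · act t n u μ - act t n u μ k * (coeff · simpleRoot k)
      ≡⟨ cong (λ x → coeff · act t n u μ - act t n u μ k * x)
           (orthogonal k (λ k≡i → i∉k∷u (here (sym k≡i)))) ⟩
        coeff · act t n u μ - act t n u μ k * + 0
      ≡⟨ minus-zero (coeff · act t n u μ) (act t n u μ k) ⟩
        coeff · act t n u μ
      ≡⟨ ·-act-∉ u μ (i∉k∷u ∘′ there) ⟩
        coeff · μ ∎
      where
      open ≡-Reasoning
      minus-zero : ∀ a b → a - b * + 0 ≡ a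
      minus-zero = solve-∀

    ·-simpleRoot-nonneg : ∀ k → + 0 ℤ.≤ coeff · simpleRoot k
    ·-simpleRoot-nonneg k with k Fin.≟ i
    ... | yes refl = ℤP.<⇒≤ positive
    ... | no k≢i = ℤP.≤-reflexive (sym (orthogonal k k≢i))

    ·-sRefl-minuscule : ∀ k μ → μ k ≡ + 1 → coeff · sRefl t n k μ + coeff · simpleRoot k ≡ coeff · μ
    ·-sRefl-minuscule k μ μk≡1 = begin
        coeff · sRefl t n k μ + coeff · simpleRoot k
      ≡⟨ cong (_+ coeff · simpleRoot k) (·-sRefl coeff k μ) ⟩
        coeff · μ - μ k * (coeff · simpleRoot k) + coeff · simpleRoot k
      ≡⟨ cong (λ x → coeff · μ - x * (coeff · simpleRoot k) + coeff · simpleRoot k) μk≡1 ⟩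
        coeff · μ - + 1 * (coeff · simpleRoot k) + coeff · simpleRoot k
      ≡⟨ cancel (coeff · μ) (coeff · simpleRoot k) ⟩
        coeff · μ ∎
      where
      open ≡-Reasoning
      cancel : ∀ a c → a - + 1 * c + c ≡ a
      cancel = solve-∀

    ·-sRefl-minuscule-≤ : ∀ k μ → μ k ≡ + 1 → coeff · sRefl t n k μ ℤ.≤ coeff · μ
    ·-sRefl-minuscule-≤ k μ μk≡1 = subst (coeff · sRefl t n k μ ℤ.≤_) (·-sRefl-minuscule k μ μk≡1)
      (ℤP.i≤i+j _ _ ⦃ ℤ.nonNegative (·-simpleRoot-nonneg k) ⦄)

    ·-sRefl-minuscule-< : ∀ μ → μ i ≡ + 1 → coeff · sRefl t n i μ ℤ.< coeff · μ
    ·-sRefl-minuscule-< μ μi≡1 = subst₂ ℤ._<_ (ℤP.+-identityʳ _) (·-sRefl-minuscule i μ μi≡1)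
      (ℤP.+-monoʳ-< (coeff · sRefl t n i μ) positive)

    ·-act-minuscule-≤ : ∀ Λ u → MinWord t n Λ u → coeff · act t n u Λ ℤ.≤ coeff · Λ
    ·-act-minuscule-≤ Λ [] _ = ℤP.≤-refl
    ·-act-minuscule-≤ Λ (k ∷ u) (on-k , min) =
      ℤP.≤-trans (·-sRefl-minuscule-≤ k (act t n u Λ) on-k) (·-act-minuscule-≤ Λ u min)

    ·-act-minuscule-< : ∀ Λ u → MinWord t n Λ u → i ∈ u → coeff · act t n u Λ ℤ.< coeff · Λ
    ·-act-minuscule-< Λ (k ∷ u) (on-k , min) (here refl) =
      ℤP.<-≤-trans (·-sRefl-minuscule-< (act t n u Λ) on-k) (·-act-minuscule-≤ Λ u min)
    ·-act-minuscule-< Λ (k ∷ u) (on-k , min) (there i∈u) =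
      ℤP.≤-<-trans (·-sRefl-minuscule-≤ k (act t n u Λ) on-k) (·-act-minuscule-< Λ u min i∈u)

  infixl 6 _+ʷ_

  _+ʷ_ : Weight n → Weight n → Weight n
  (μ +ʷ ν) j = μ j + ν j

  act-+ʷ : ∀ u μ ν j → act t n u (μ +ʷ ν) j ≡ act t n u μ j + act t n u ν j
  act-+ʷ [] μ ν j = refl
  act-+ʷ (k ∷ u) μ ν j rewrite act-+ʷ u μ ν j | act-+ʷ u μ ν k =
    distrib (act t n u μ j) (act t n u ν j) (act t n u μ k) (act t n u ν k) (cartan t n j k)
    where
    distrib : ∀ a b c d e → a + b - (c + d) * e ≡ a - c * e + (b - d * e)
    distrib = solve-∀

  act-fixed : ∀ u ν j → All (λ k → ν k ≡ + 0) u → act t n u ν j ≡ ν j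
  act-fixed [] ν j _ = refl
  act-fixed (k ∷ u) ν j (νk≡0 ∷ fixed)
    rewrite act-fixed u ν j fixed | act-fixed u ν k fixed | νk≡0 = minus-zero (ν j) (cartan t n j k)
    where
    minus-zero : ∀ a b → a - + 0 * b ≡ a
    minus-zero = solve-∀

  MinWord-+ʷ : ∀ Λ ν u → All (λ k → ν k ≡ + 0) u → MinWord t n Λ u → MinWord t n (Λ +ʷ ν) u
  MinWord-+ʷ Λ ν [] _ _ = tt
  MinWord-+ʷ Λ ν (k ∷ u) (νk≡0 ∷ fixed) (on-k , min) =
    trans (act-+ʷ u Λ ν k) (cong₂ _+_ on-k (trans (act-fixed u ν k fixed) νk≡0)) ,
    MinWord-+ʷ Λ ν u fixed min

  fundamentalWeight : Fin n → Weight n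
  fundamentalWeight i j with j Fin.≟ i
  ... | yes _ = + 1
  ... | no _ = + 0

  fundamentalWeight-≢ : ∀ {i k} → k ≢ i → fundamentalWeight i k ≡ + 0
  fundamentalWeight-≢ {i} {k} k≢i with k Fin.≟ i
  ... | yes k≡i = contradiction k≡i k≢i
  ... | no _ = refl

  fundamentalWeight-self : ∀ i → fundamentalWeight i i ≡ + 1
  fundamentalWeight-self i with i Fin.≟ i
  ... | yes _ = refl
  ... | no i≢i = contradiction refl i≢i

  fundamentalWeight-dominant : ∀ i → Dominant (fundamentalWeight i)
  fundamentalWeight-dominant i j with j Fin.≟ i
  ... | yes _ = ℤ.+≤+ z≤n
  ... | no _ = ℤ.+≤+ z≤n

  strongMinuscule-support : ∀ {i w v} → FundamentalCoweight i →
    StrongMinuscule t n w → SameElt t n v w → i ∈ v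
  strongMinuscule-support {i} {w} {v} ϖ
    (Λ , (Λ-dominant , v₀ , (v₀-reduced , v₀≡w) , v₀-minuscule) , Λ-unique) v≡w =
    decidable-stable (i ∈? v) λ i∉v → case i ∈? v₀ of λ where
      (yes i∈v₀) → ℤP.<-irrefl (v₀-preserves i∉v) (·-act-minuscule-< ϖ Λ v₀ v₀-minuscule i∈v₀)
      (no i∉v₀) → ℤP.i≢suc[i] (sym (trans (ℤP.+-comm (+ 1) (Λ i)) (Λ+Λᵢ-minuscule i∉v₀)))
    where
    open FundamentalCoweight ϖ

    v₀-preserves : i ∉ v → coeff · act t n v₀ Λ ≡ coeff · Λ
    v₀-preserves i∉v = trans
      (sum-cong-≗ (λ j → cong (coeff j *_) (trans (v₀≡w Λ j) (sym (v≡w Λ j)))))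
      (·-act-∉ ϖ v Λ i∉v)

    Λ+Λᵢ-minuscule : i ∉ v₀ → Λ i + + 1 ≡ Λ i
    Λ+Λᵢ-minuscule i∉v₀ = trans (cong (λ x → Λ i + x) (sym (fundamentalWeight-self i)))
      (Λ-unique (Λ +ʷ fundamentalWeight i)
        (λ j → ℤP.+-mono-≤ (Λ-dominant j) (fundamentalWeight-dominant i j))
        (v₀ , (v₀-reduced , v₀≡w) , MinWord-+ʷ Λ _ v₀ fixes v₀-minuscule) i)
      where
      fixes : All (λ k → fundamentalWeight i k ≡ + 0) v₀
      fixes = All.map (λ i≢k → fundamentalWeight-≢ (i≢k ∘′ sym)) (¬Any⇒All¬ v₀ i∉v₀)

-- Column sums of the Cartan matrix

≡ᵇ-refl : ∀ m → (m ≡ᵇ m) ≡ true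
≡ᵇ-refl m = dec-true (m ℕ.≟ m) refl

≢⇒≡ᵇ-false : ∀ {m n} → m ≢ n → (m ≡ᵇ n) ≡ false
≢⇒≡ᵇ-false {m} {n} = dec-false (m ℕ.≟ n)

δ : ℕ → ℕ → ℤ
δ p j = if j ≡ᵇ p then + 1 else + 0

δ-refl : ∀ p → δ p p ≡ + 1
δ-refl p rewrite ≡ᵇ-refl p = refl

δ-≢ : ∀ {p j} → j ≢ p → δ p j ≡ + 0
δ-≢ j≢p rewrite ≢⇒≡ᵇ-false j≢p = refl

-- ∑ n f = f 1 + ⋯ + f n: indices are 1-based, as in cartanℕ.
∑ : ℕ → (ℕ → ℤ) → ℤ
∑ n f = sum {n} (λ j → f (suc (toℕ j)))

column : CartanType → ℕ → (ℕ → ℤ) → ℕ → ℤ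
column t n X K = ∑ n (λ j → X j * cartanℕ t n j K)

restrict : ℕ → (ℕ → ℤ) → ℕ → ℤ
restrict n X p = ∑ n (λ j → X j * δ p j)

restrict-zero : ∀ n X → restrict n X 0 ≡ + 0
restrict-zero n X = trans (sum-cong-≗ {n} (λ j → ℤP.*-zeroʳ (X (suc (toℕ j))))) (sum-replicate-zero n)

restrict-inside : ∀ n X p → p ℕ.< n → restrict n X (suc p) ≡ X (suc p)
restrict-inside (suc n) X zero _ =
  trans (cong₂ _+_ (ℤP.*-identityʳ (X 1)) (restrict-zero n (λ j → X (suc j)))) (ℤP.+-identityʳ (X 1))
restrict-inside (suc n) X (suc p) (s≤s p<n) =
  trans (cong₂ _+_ (ℤP.*-zeroʳ (X 1)) (restrict-inside n (λ j → X (suc j)) p p<n)) (ℤP.+-identityˡ _)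

restrict-above : ∀ n X p → n ℕ.< p → restrict n X p ≡ + 0
restrict-above zero X p _ = refl
restrict-above (suc n) X (suc (suc p)) (s≤s n<p) =
  trans (cong₂ _+_ (ℤP.*-zeroʳ (X 1)) (restrict-above n (λ j → X (suc j)) (suc p) n<p)) (ℤP.+-identityˡ _)

restrict-≤ : ∀ n X p → X 0 ≡ + 0 → p ℕ.≤ n → restrict n X p ≡ X p
restrict-≤ n X zero X0≡0 _ = trans (restrict-zero n X) (sym X0≡0)
restrict-≤ n X (suc p) _ p<n = restrict-inside n X p p<n

-- A combination lists pairs (c , p) standing for c times the p-th unit vector.
Combination : Set
Combination = List (ℤ × ℕ)

⟦_⟧ : Combination → ℕ → ℤ
⟦ [] ⟧ j = + 0
⟦ (c , p) ∷ L ⟧ j = c * δ p j + ⟦ L ⟧ j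

⟪_⟫ : Combination → (ℕ → ℤ) → ℤ
⟪ [] ⟫ Y = + 0
⟪ (c , p) ∷ L ⟫ Y = c * Y p + ⟪ L ⟫ Y

⟪⟫-++ : ∀ L L′ Y → ⟪ L ++ L′ ⟫ Y ≡ ⟪ L ⟫ Y + ⟪ L′ ⟫ Y
⟪⟫-++ [] L′ Y = sym (ℤP.+-identityˡ _)
⟪⟫-++ ((c , p) ∷ L) L′ Y =
  trans (cong (λ x → c * Y p + x) (⟪⟫-++ L L′ Y)) (sym (ℤP.+-assoc (c * Y p) _ _))

⟪⟫-restrict : ∀ n X L → X 0 ≡ + 0 → All (λ e → proj₂ e ℕ.≤ n) L →
  ⟪ L ⟫ (restrict n X) ≡ ⟪ L ⟫ X
⟪⟫-restrict n X [] _ [] = refl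
⟪⟫-restrict n X ((c , p) ∷ L) X0≡0 (p≤n ∷ L≤n) =
  cong₂ _+_ (cong (c *_) (restrict-≤ n X p X0≡0 p≤n)) (⟪⟫-restrict n X L X0≡0 L≤n)

∑-⟦⟧ : ∀ n X L → ∑ n (λ j → X j * ⟦ L ⟧ j) ≡ ⟪ L ⟫ (restrict n X)
∑-⟦⟧ n X [] = restrict-zero n X
∑-⟦⟧ n X ((c , p) ∷ L) = begin
    ∑ n (λ j → X j * (c * δ p j + ⟦ L ⟧ j))
  ≡⟨ sum-cong-≗ {n} (λ j → distrib (X (suc (toℕ j))) c (δ p (suc (toℕ j))) (⟦ L ⟧ (suc (toℕ j)))) ⟩
    ∑ n (λ j → c * (X j * δ p j) + X j * ⟦ L ⟧ j)
  ≡⟨ ∑-distrib-+ {n} (λ j → c * (X (suc (toℕ j)) * δ p (suc (toℕ j))))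
                     (λ j → X (suc (toℕ j)) * ⟦ L ⟧ (suc (toℕ j))) ⟩
    ∑ n (λ j → c * (X j * δ p j)) + ∑ n (λ j → X j * ⟦ L ⟧ j)
  ≡⟨ cong₂ _+_ (sym (*-distribˡ-sum {n} c (λ j → X (suc (toℕ j)) * δ p (suc (toℕ j))))) (∑-⟦⟧ n X L) ⟩
    c * restrict n X p + ⟪ L ⟫ (restrict n X) ∎
  where
  open ≡-Reasoning
  distrib : ∀ x c d r → x * (c * d + r) ≡ c * (x * d) + x * r
  distrib = solve-∀

column-⟦⟧ : ∀ {t n K} X L → (∀ j → cartanℕ t n j K ≡ ⟦ L ⟧ j) →
  column t n X K ≡ ⟪ L ⟫ (restrict n X)
column-⟦⟧ {n = n} X L col≡L =
  trans (sum-cong-≗ {n} (λ j → cong (X (suc (toℕ j)) *_) (col≡L (suc (toℕ j))))) (∑-⟦⟧ n X L)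

column-⟦⟧-inside : ∀ {t n K} X L → (∀ j → cartanℕ t n j K ≡ ⟦ L ⟧ j) →
  X 0 ≡ + 0 → All (λ e → proj₂ e ℕ.≤ n) L → column t n X K ≡ ⟪ L ⟫ X
column-⟦⟧-inside {t} {n} X L col≡L X0≡0 L≤n =
  trans (column-⟦⟧ {t} X L col≡L) (⟪⟫-restrict n X L X0≡0 L≤n)

-- The last column of a chain also has an entry in the nonexistent row n + 1; the sum ignores it.
column-⟦⟧-last : ∀ {t n K} X L c → (∀ j → cartanℕ t n j K ≡ ⟦ L ++ (c , suc n) ∷ [] ⟧ j) →
  X 0 ≡ + 0 → All (λ e → proj₂ e ℕ.≤ n) L → column t n X K ≡ ⟪ L ⟫ X
column-⟦⟧-last {t} {n} X L c col≡L X0≡0 L≤n = begin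
    column t n X _
  ≡⟨ column-⟦⟧ {t} X (L ++ (c , suc n) ∷ []) col≡L ⟩
    ⟪ L ++ (c , suc n) ∷ [] ⟫ (restrict n X)
  ≡⟨ ⟪⟫-++ L _ (restrict n X) ⟩
    ⟪ L ⟫ (restrict n X) + (c * restrict n X (suc n) + + 0)
  ≡⟨ cong₂ _+_ (⟪⟫-restrict n X L X0≡0 L≤n)
               (cong (λ x → c * x + + 0) (restrict-above n X (suc n) ℕP.≤-refl)) ⟩
    ⟪ L ⟫ X + (c * + 0 + + 0)
  ≡⟨ cong (λ x → ⟪ L ⟫ X + x) (trans (ℤP.+-identityʳ _) (ℤP.*-zeroʳ c)) ⟩
    ⟪ L ⟫ X + + 0
  ≡⟨ ℤP.+-identityʳ _ ⟩
    ⟪ L ⟫ X ∎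
  where open ≡-Reasoning

-- Columns of the classical Cartan matrices

-- Shifting row, column and rank by one leaves every entry of cartanℕ t n unchanged (for n ≥ 2),
-- so each column near the end of the diagram reduces to the smallest rank, checked entry by entry.

chain : ℕ → Combination
chain k = (+ 2 , suc k) ∷ (-1ℤ , k) ∷ (-1ℤ , 2 ℕ.+ k) ∷ []

cartanA-chain : ∀ n k j → cartanℕ A n j (suc k) ≡ ⟦ chain k ⟧ j
cartanA-chain n zero 0 = refl
cartanA-chain n zero 1 = refl
cartanA-chain n zero 2 = refl
cartanA-chain n zero (suc (suc (suc j))) = refl
cartanA-chain n (suc k) zero = refl
cartanA-chain n (suc k) (suc j) = cartanA-chain n k j

cartanB-chain : ∀ n k j → 2 ℕ.+ k ≢ n → cartanℕ B n j (suc k) ≡ ⟦ chain k ⟧ j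
cartanB-chain n k j k+2≢n rewrite ≢⇒≡ᵇ-false k+2≢n | ∧-zeroʳ (j ≡ᵇ n) = cartanA-chain n k j

penultimateB : ℕ → Combination
penultimateB m = (+ 2 , 1 ℕ.+ m) ∷ (-1ℤ , m) ∷ (- + 2 , 2 ℕ.+ m) ∷ []

cartanB-penultimate : ∀ m j → cartanℕ B (2 ℕ.+ m) j (1 ℕ.+ m) ≡ ⟦ penultimateB m ⟧ j
cartanB-penultimate zero 0 = refl
cartanB-penultimate zero 1 = refl
cartanB-penultimate zero 2 = refl
cartanB-penultimate zero (suc (suc (suc j))) = refl
cartanB-penultimate (suc m) zero = refl
cartanB-penultimate (suc m) (suc j) = cartanB-penultimate m j

cartanC-chain : ∀ n k j → suc k ≢ n → cartanℕ C n j (suc k) ≡ ⟦ chain k ⟧ j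
cartanC-chain n k j k+1≢n rewrite ≢⇒≡ᵇ-false k+1≢n | ∧-zeroʳ (suc j ≡ᵇ n) = cartanA-chain n k j

lastC : ℕ → Combination
lastC m = (+ 2 , 2 ℕ.+ m) ∷ (- + 2 , 1 ℕ.+ m) ∷ []

cartanC-last : ∀ m j → cartanℕ C (2 ℕ.+ m) j (2 ℕ.+ m) ≡ ⟦ lastC m ++ (-1ℤ , 3 ℕ.+ m) ∷ [] ⟧ j
cartanC-last zero 0 = refl
cartanC-last zero 1 = refl
cartanC-last zero 2 = refl
cartanC-last zero 3 = refl
cartanC-last zero (suc (suc (suc (suc j)))) = refl
cartanC-last (suc m) zero = refl
cartanC-last (suc m) (suc j) = cartanC-last m j

cartanD-chain : ∀ m k j → k ℕ.≤ m → cartanℕ D (4 ℕ.+ m) j (suc k) ≡ ⟦ chain k ⟧ j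
cartanD-chain m k j k≤m
  rewrite ≢⇒≡ᵇ-false (ℕP.<⇒≢ (s≤s k≤m))
        | ≢⇒≡ᵇ-false (ℕP.<⇒≢ (s≤s (ℕP.m≤n⇒m≤1+n k≤m)))
        | ≢⇒≡ᵇ-false (ℕP.<⇒≢ (s≤s (ℕP.m≤n⇒m≤1+n (ℕP.m≤n⇒m≤1+n k≤m))))
        | ∧-zeroʳ (j ≡ᵇ 2 ℕ.+ m) | ∧-zeroʳ (j ≡ᵇ 3 ℕ.+ m) | ∧-zeroʳ (j ≡ᵇ 4 ℕ.+ m)
  = cartanA-chain (4 ℕ.+ m) k j

antepenultimateD : ℕ → Combination
antepenultimateD m = (+ 2 , 2 ℕ.+ m) ∷ (-1ℤ , 1 ℕ.+ m) ∷ (-1ℤ , 3 ℕ.+ m) ∷ (-1ℤ , 4 ℕ.+ m) ∷ []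

cartanD-antepenultimate : ∀ m j → cartanℕ D (4 ℕ.+ m) j (2 ℕ.+ m) ≡ ⟦ antepenultimateD m ⟧ j
cartanD-antepenultimate zero 0 = refl
cartanD-antepenultimate zero 1 = refl
cartanD-antepenultimate zero 2 = refl
cartanD-antepenultimate zero 3 = refl
cartanD-antepenultimate zero 4 = refl
cartanD-antepenultimate zero (suc (suc (suc (suc (suc j))))) = refl
cartanD-antepenultimate (suc m) zero = refl
cartanD-antepenultimate (suc m) (suc j) = cartanD-antepenultimate m j

penultimateD : ℕ → Combination
penultimateD m = (+ 2 , 3 ℕ.+ m) ∷ (-1ℤ , 2 ℕ.+ m) ∷ []

cartanD-penultimate : ∀ m j → cartanℕ D (4 ℕ.+ m) j (3 ℕ.+ m) ≡ ⟦ penultimateD m ⟧ j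
cartanD-penultimate zero 0 = refl
cartanD-penultimate zero 1 = refl
cartanD-penultimate zero 2 = refl
cartanD-penultimate zero 3 = refl
cartanD-penultimate zero 4 = refl
cartanD-penultimate zero (suc (suc (suc (suc (suc j))))) = refl
cartanD-penultimate (suc m) zero = refl
cartanD-penultimate (suc m) (suc j) = cartanD-penultimate m j

lastD : ℕ → Combination
lastD m = (+ 2 , 4 ℕ.+ m) ∷ (-1ℤ , 2 ℕ.+ m) ∷ []

cartanD-last : ∀ m j → cartanℕ D (4 ℕ.+ m) j (4 ℕ.+ m) ≡ ⟦ lastD m ++ (-1ℤ , 5 ℕ.+ m) ∷ [] ⟧ j
cartanD-last zero 0 = refl
cartanD-last zero 1 = refl
cartanD-last zero 2 = refl
cartanD-last zero 3 = refl
cartanD-last zero 4 = refl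
cartanD-last zero 5 = refl
cartanD-last zero (suc (suc (suc (suc (suc (suc j)))))) = refl
cartanD-last (suc m) zero = refl
cartanD-last (suc m) (suc j) = cartanD-last m j

-- Fundamental coweights of the classical types

-- Along a chain of the diagram the column sums of X are the negated second differences Δ² X,
-- and Δ² (clamp I) is the unit vector at I. Each coweight below is a multiple of clamp I (plus,
-- for A, a linear term, which Δ² kills) with its coefficients at the end of the diagram adjusted
-- to the last columns.

clamp : ℕ → ℕ → ℤ
clamp I j = + (j ⊓ I)

clamp-≥ : ∀ {I j} → I ℕ.≤ j → clamp I j ≡ + I
clamp-≥ I≤j = cong +_ (ℕP.m≥n⇒m⊓n≡n I≤j)

Δ² : (ℕ → ℤ) → ℕ → ℤ
Δ² f k = + 2 * f (suc k) - f k - f (2 ℕ.+ k)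

Δ²-cong : ∀ {f g} k → f k ≡ g k → f (suc k) ≡ g (suc k) → f (2 ℕ.+ k) ≡ g (2 ℕ.+ k) →
  Δ² f k ≡ Δ² g k
Δ²-cong k eq₀ eq₁ eq₂ = cong₂ _-_ (cong₂ _-_ (cong (+ 2 *_) eq₁) eq₀) eq₂

Δ²-double : ∀ f k → Δ² (λ j → + 2 * f j) k ≡ + 2 * Δ² f k
Δ²-double f k = distrib (f k) (f (suc k)) (f (2 ℕ.+ k))
  where
  distrib : ∀ a b c → + 2 * (+ 2 * b) - + 2 * a - + 2 * c ≡ + 2 * (+ 2 * b - a - c)
  distrib = solve-∀

Δ²-clamp : ∀ I k → Δ² (clamp I) k ≡ δ I (suc k)
Δ²-clamp zero zero = refl
Δ²-clamp zero (suc k) = refl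
Δ²-clamp (suc zero) zero = refl
Δ²-clamp (suc (suc I)) zero = refl
Δ²-clamp (suc I) (suc k) = trans (shift (clamp I k) (clamp I (suc k)) (clamp I (2 ℕ.+ k))) (Δ²-clamp I k)
  where
  shift : ∀ a b c → + 2 * (+ 1 + b) - (+ 1 + a) - (+ 1 + c) ≡ + 2 * b - a - c
  shift = solve-∀

clamp-step : ∀ I k → clamp I (suc k) - clamp I k ≡ δ I (suc k) + (clamp I (2 ℕ.+ k) - clamp I (suc k))
clamp-step I k = trans (regroup (clamp I k) (clamp I (suc k)) (clamp I (2 ℕ.+ k)))
  (cong (ℤ._+ (clamp I (2 ℕ.+ k) - clamp I (suc k))) (Δ²-clamp I k))
  where
  regroup : ∀ a b c → b - a ≡ (+ 2 * b - a - c) + (c - b)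
  regroup = solve-∀

clamp-step-last : ∀ I k → I ℕ.≤ suc k → clamp I (suc k) - clamp I k ≡ δ I (suc k)
clamp-step-last I k I≤k+1 = begin
    clamp I (suc k) - clamp I k
  ≡⟨ clamp-step I k ⟩
    δ I (suc k) + (clamp I (2 ℕ.+ k) - clamp I (suc k))
  ≡⟨ cong (λ x → δ I (suc k) + (x - clamp I (suc k)))
       (trans (clamp-≥ (ℕP.m≤n⇒m≤1+n I≤k+1)) (sym (clamp-≥ I≤k+1))) ⟩
    δ I (suc k) + (clamp I (suc k) - clamp I (suc k))
  ≡⟨ trans (cong (λ x → δ I (suc k) + x) (ℤP.+-inverseʳ (clamp I (suc k)))) (ℤP.+-identityʳ _) ⟩
    δ I (suc k) ∎
  where open ≡-Reasoning

⟪chain⟫ : ∀ k Y → ⟪ chain k ⟫ Y ≡ Δ² Y k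
⟪chain⟫ k Y = shape (Y k) (Y (suc k)) (Y (2 ℕ.+ k))
  where
  shape : ∀ a b c → + 2 * b + (-1ℤ * a + (-1ℤ * c + + 0)) ≡ + 2 * b - a - c
  shape = solve-∀

column-chain : ∀ {t n k} X → (∀ j → cartanℕ t n j (suc k) ≡ ⟦ chain k ⟧ j) →
  X 0 ≡ + 0 → 2 ℕ.+ k ℕ.≤ n → column t n X (suc k) ≡ Δ² X k
column-chain {t} {n} {k} X col≡chain X0≡0 k+2≤n = trans
  (column-⟦⟧-inside {t} X (chain k) col≡chain X0≡0 (k+1≤n ∷ k≤n ∷ k+2≤n ∷ []))
  (⟪chain⟫ k X)
  where
  k+1≤n : suc k ℕ.≤ n
  k+1≤n = ℕP.≤-trans (ℕP.n≤1+n (suc k)) k+2≤n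
  k≤n : k ℕ.≤ n
  k≤n = ℕP.≤-trans (ℕP.n≤1+n k) k+1≤n

column-chain-last : ∀ {t k} X → (∀ j → cartanℕ t (suc k) j (suc k) ≡ ⟦ chain k ⟧ j) →
  X 0 ≡ + 0 → column t (suc k) X (suc k) ≡ + 2 * X (suc k) - X k
column-chain-last {t} {k} X col≡chain X0≡0 = trans
  (column-⟦⟧-last {t} X ((+ 2 , suc k) ∷ (-1ℤ , k) ∷ []) -1ℤ col≡chain X0≡0
    (ℕP.≤-refl ∷ ℕP.n≤1+n k ∷ []))
  (shape (X k) (X (suc k)))
  where
  shape : ∀ a b → + 2 * b + (-1ℤ * a + + 0) ≡ + 2 * b - a
  shape = solve-∀

IsFundamentalCoweight : CartanType → ℕ → ℕ → (ℕ → ℤ) → Set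
IsFundamentalCoweight t n I X = ∀ k → k ℕ.< n → ∃[ c ] column t n X (suc k) ≡ + suc c * δ I (suc k)

coweightA : ℕ → ℕ → ℕ → ℤ
coweightA n I j = + suc n * clamp I j - + I * + j

coweightA-zero : ∀ n I → coweightA n I 0 ≡ + 0
coweightA-zero n I = vanish (+ suc n) (+ I)
  where
  vanish : ∀ a b → a * + 0 - b * + 0 ≡ + 0
  vanish = solve-∀

coweightA-beyond : ∀ n I → I ℕ.≤ n → coweightA n I (suc n) ≡ + 0
coweightA-beyond n I I≤n = trans (cong (λ x → + suc n * x - + I * + suc n) (clamp-≥ (ℕP.m≤n⇒m≤1+n I≤n)))
  (cancel (+ suc n) (+ I))
  where
  cancel : ∀ a b → a * b - b * a ≡ + 0
  cancel = solve-∀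

Δ²-coweightA : ∀ n I k → Δ² (coweightA n I) k ≡ + suc n * δ I (suc k)
Δ²-coweightA n I k = trans
  (linear (+ suc n) (+ I) (clamp I k) (clamp I (suc k)) (clamp I (2 ℕ.+ k)) (+ k))
  (cong (+ suc n *_) (Δ²-clamp I k))
  where
  linear : ∀ N I a b c k → + 2 * (N * b - I * (+ 1 + k)) - (N * a - I * k) - (N * c - I * (+ 2 + k))
                           ≡ N * (+ 2 * b - a - c)
  linear = solve-∀

isFundamentalCoweightA : ∀ n I → I ℕ.≤ n → IsFundamentalCoweight A n I (coweightA n I)
isFundamentalCoweightA n I I≤n k k<n with ℕP.m≤n⇒m<n∨m≡n k<n
... | inj₁ k+1<n = n , trans (column-chain {A} (coweightA n I) (cartanA-chain n k) (coweightA-zero n I) k+1<n)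
                             (Δ²-coweightA n I k)
... | inj₂ refl = suc k , (begin
    column A (suc k) X (suc k)
  ≡⟨ column-chain-last {A} X (cartanA-chain (suc k) k) (coweightA-zero (suc k) I) ⟩
    + 2 * X (suc k) - X k
  ≡⟨ sym (trans (cong (λ x → + 2 * X (suc k) - X k - x) (coweightA-beyond (suc k) I I≤n)) (ℤP.+-identityʳ _)) ⟩
    Δ² X k
  ≡⟨ Δ²-coweightA (suc k) I k ⟩
    + suc (suc k) * δ I (suc k) ∎)
  where
  open ≡-Reasoning
  X : ℕ → ℤ
  X = coweightA (suc k) I

coweightB : ℕ → ℕ → ℕ → ℤ
coweightB m I j = if j ≡ᵇ 2 ℕ.+ m then clamp I j else + 2 * clamp I j

coweightB-< : ∀ m I {j} → j ℕ.< 2 ℕ.+ m → coweightB m I j ≡ + 2 * clamp I j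
coweightB-< m I j<n rewrite ≢⇒≡ᵇ-false (ℕP.<⇒≢ j<n) = refl

coweightB-last : ∀ m I → coweightB m I (2 ℕ.+ m) ≡ clamp I (2 ℕ.+ m)
coweightB-last m I rewrite ≡ᵇ-refl m = refl

columnB-chain : ∀ m I k → 2 ℕ.+ k ℕ.≤ suc m → column B (2 ℕ.+ m) (coweightB m I) (suc k) ≡ + 2 * δ I (suc k)
columnB-chain m I k k+2≤n-1 = begin
    column B (2 ℕ.+ m) X (suc k)
  ≡⟨ column-chain {B} X (λ j → cartanB-chain (2 ℕ.+ m) k j (ℕP.<⇒≢ (s≤s k+2≤n-1))) refl
       (ℕP.m≤n⇒m≤1+n k+2≤n-1) ⟩
    Δ² X k
  ≡⟨ Δ²-cong {X} {λ j → + 2 * clamp I j} k (coweightB-< m I (ℕP.m≤n⇒m≤1+n (ℕP.<⇒≤ k+2≤n-1)))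
       (coweightB-< m I (ℕP.m≤n⇒m≤1+n k+2≤n-1)) (coweightB-< m I (s≤s k+2≤n-1)) ⟩
    Δ² (λ j → + 2 * clamp I j) k
  ≡⟨ Δ²-double (clamp I) k ⟩
    + 2 * Δ² (clamp I) k
  ≡⟨ cong (+ 2 *_) (Δ²-clamp I k) ⟩
    + 2 * δ I (suc k) ∎
  where
  open ≡-Reasoning
  X : ℕ → ℤ
  X = coweightB m I

columnB-penultimate : ∀ m I → column B (2 ℕ.+ m) (coweightB m I) (suc m) ≡ + 2 * δ I (suc m)
columnB-penultimate m I = begin
    column B (2 ℕ.+ m) X (suc m)
  ≡⟨ column-⟦⟧-inside {B} X (penultimateB m) (cartanB-penultimate m) refl
       (ℕP.n≤1+n _ ∷ ℕP.m≤n+m m 2 ∷ ℕP.≤-refl ∷ []) ⟩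
    + 2 * X (suc m) + (-1ℤ * X m + (- + 2 * X (2 ℕ.+ m) + + 0))
  ≡⟨ cong₂ (λ x y → + 2 * x + (-1ℤ * y + (- + 2 * X (2 ℕ.+ m) + + 0)))
       (coweightB-< m I ℕP.≤-refl) (coweightB-< m I (ℕP.m≤n+m (suc m) 1)) ⟩
    + 2 * (+ 2 * clamp I (suc m)) + (-1ℤ * (+ 2 * clamp I m) + (- + 2 * X (2 ℕ.+ m) + + 0))
  ≡⟨ cong (λ x → + 2 * (+ 2 * clamp I (suc m)) + (-1ℤ * (+ 2 * clamp I m) + (- + 2 * x + + 0)))
       (coweightB-last m I) ⟩
    + 2 * (+ 2 * clamp I (suc m)) + (-1ℤ * (+ 2 * clamp I m) + (- + 2 * clamp I (2 ℕ.+ m) + + 0))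
  ≡⟨ shape (clamp I m) (clamp I (suc m)) (clamp I (2 ℕ.+ m)) ⟩
    + 2 * Δ² (clamp I) m
  ≡⟨ cong (+ 2 *_) (Δ²-clamp I m) ⟩
    + 2 * δ I (suc m) ∎
  where
  open ≡-Reasoning
  X : ℕ → ℤ
  X = coweightB m I
  shape : ∀ a b c → + 2 * (+ 2 * b) + (-1ℤ * (+ 2 * a) + (- + 2 * c + + 0)) ≡ + 2 * (+ 2 * b - a - c)
  shape = solve-∀

columnB-last : ∀ m I → I ℕ.≤ 2 ℕ.+ m →
  column B (2 ℕ.+ m) (coweightB m I) (2 ℕ.+ m) ≡ + 2 * δ I (2 ℕ.+ m)
columnB-last m I I≤n = begin
    column B (2 ℕ.+ m) X (2 ℕ.+ m)
  ≡⟨ column-chain-last {B} X (λ j → cartanB-chain (2 ℕ.+ m) (suc m) j ℕP.1+n≢n) refl ⟩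
    + 2 * X (2 ℕ.+ m) - X (suc m)
  ≡⟨ cong₂ (λ x y → + 2 * x - y) (coweightB-last m I) (coweightB-< m I ℕP.≤-refl) ⟩
    + 2 * clamp I (2 ℕ.+ m) - + 2 * clamp I (suc m)
  ≡⟨ factor (clamp I (2 ℕ.+ m)) (clamp I (suc m)) ⟩
    + 2 * (clamp I (2 ℕ.+ m) - clamp I (suc m))
  ≡⟨ cong (+ 2 *_) (clamp-step-last I (suc m) I≤n) ⟩
    + 2 * δ I (2 ℕ.+ m) ∎
  where
  open ≡-Reasoning
  X : ℕ → ℤ
  X = coweightB m I
  factor : ∀ a b → + 2 * a - + 2 * b ≡ + 2 * (a - b)
  factor = solve-∀

isFundamentalCoweightB : ∀ m I → I ℕ.≤ 2 ℕ.+ m → IsFundamentalCoweight B (2 ℕ.+ m) I (coweightB m I)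
isFundamentalCoweightB m I I≤n k k<n with ℕP.m≤n⇒m<n∨m≡n k<n
... | inj₂ refl = 1 , columnB-last m I I≤n
... | inj₁ k+1<n with ℕP.m≤n⇒m<n∨m≡n (ℕ.s≤s⁻¹ k+1<n)
...   | inj₂ refl = 1 , columnB-penultimate m I
...   | inj₁ k+2<n = 1 , columnB-chain m I k k+2<n

columnC-last : ∀ m I → I ℕ.≤ 2 ℕ.+ m → column C (2 ℕ.+ m) (clamp I) (2 ℕ.+ m) ≡ + 2 * δ I (2 ℕ.+ m)
columnC-last m I I≤n = begin
    column C (2 ℕ.+ m) (clamp I) (2 ℕ.+ m)
  ≡⟨ column-⟦⟧-last {C} (clamp I) (lastC m) -1ℤ (cartanC-last m) refl (ℕP.≤-refl ∷ ℕP.n≤1+n _ ∷ []) ⟩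
    + 2 * clamp I (2 ℕ.+ m) + (- + 2 * clamp I (suc m) + + 0)
  ≡⟨ factor (clamp I (2 ℕ.+ m)) (clamp I (suc m)) ⟩
    + 2 * (clamp I (2 ℕ.+ m) - clamp I (suc m))
  ≡⟨ cong (+ 2 *_) (clamp-step-last I (suc m) I≤n) ⟩
    + 2 * δ I (2 ℕ.+ m) ∎
  where
  open ≡-Reasoning
  factor : ∀ a b → + 2 * a + (- + 2 * b + + 0) ≡ + 2 * (a - b)
  factor = solve-∀

isFundamentalCoweightC : ∀ m I → I ℕ.≤ 2 ℕ.+ m → IsFundamentalCoweight C (2 ℕ.+ m) I (clamp I)
isFundamentalCoweightC m I I≤n k k<n with ℕP.m≤n⇒m<n∨m≡n k<n
... | inj₂ refl = 1 , columnC-last m I I≤n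
... | inj₁ k+1<n = 0 , (begin
    column C (2 ℕ.+ m) (clamp I) (suc k)
  ≡⟨ column-chain {C} (clamp I) (λ j → cartanC-chain (2 ℕ.+ m) k j (ℕP.<⇒≢ k+1<n)) refl k+1<n ⟩
    Δ² (clamp I) k
  ≡⟨ Δ²-clamp I k ⟩
    δ I (suc k)
  ≡⟨ sym (ℤP.*-identityˡ _) ⟩
    + 1 * δ I (suc k) ∎)
  where open ≡-Reasoning

coweightD : ℕ → ℕ → ℕ → ℤ
coweightD m I j =
  if j ≡ᵇ 3 ℕ.+ m then clamp I (2 ℕ.+ m) + + 2 * δ I (3 ℕ.+ m)
  else if j ≡ᵇ 4 ℕ.+ m then clamp I (2 ℕ.+ m) + + 2 * δ I (4 ℕ.+ m)
  else + 2 * clamp I j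

coweightD-< : ∀ m I {j} → j ℕ.< 3 ℕ.+ m → coweightD m I j ≡ + 2 * clamp I j
coweightD-< m I j<n-1
  rewrite ≢⇒≡ᵇ-false (ℕP.<⇒≢ j<n-1) | ≢⇒≡ᵇ-false (ℕP.<⇒≢ (ℕP.m≤n⇒m≤1+n j<n-1)) = refl

coweightD-penultimate : ∀ m I → coweightD m I (3 ℕ.+ m) ≡ clamp I (2 ℕ.+ m) + + 2 * δ I (3 ℕ.+ m)
coweightD-penultimate m I rewrite ≡ᵇ-refl m = refl

coweightD-last : ∀ m I → coweightD m I (4 ℕ.+ m) ≡ clamp I (2 ℕ.+ m) + + 2 * δ I (4 ℕ.+ m)
coweightD-last m I rewrite ≢⇒≡ᵇ-false (ℕP.1+n≢n {m}) | ≡ᵇ-refl m = refl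

columnD-chain : ∀ m I k → k ℕ.≤ m → column D (4 ℕ.+ m) (coweightD m I) (suc k) ≡ + 2 * δ I (suc k)
columnD-chain m I k k≤m = begin
    column D (4 ℕ.+ m) X (suc k)
  ≡⟨ column-chain {D} X (λ j → cartanD-chain m k j k≤m) refl
       (ℕP.≤-trans (s≤s (s≤s k≤m)) (ℕP.m≤n+m _ 2)) ⟩
    Δ² X k
  ≡⟨ Δ²-cong {X} {λ j → + 2 * clamp I j} k (coweightD-< m I (s≤s (ℕP.m≤n⇒m≤1+n (ℕP.m≤n⇒m≤1+n k≤m))))
       (coweightD-< m I (s≤s (s≤s (ℕP.m≤n⇒m≤1+n k≤m)))) (coweightD-< m I (s≤s (s≤s (s≤s k≤m)))) ⟩
    Δ² (λ j → + 2 * clamp I j) k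
  ≡⟨ Δ²-double (clamp I) k ⟩
    + 2 * Δ² (clamp I) k
  ≡⟨ cong (+ 2 *_) (Δ²-clamp I k) ⟩
    + 2 * δ I (suc k) ∎
  where
  open ≡-Reasoning
  X : ℕ → ℤ
  X = coweightD m I

columnD-antepenultimate : ∀ m I → I ℕ.≤ 4 ℕ.+ m →
  column D (4 ℕ.+ m) (coweightD m I) (2 ℕ.+ m) ≡ + 2 * δ I (2 ℕ.+ m)
columnD-antepenultimate m I I≤n = begin
    column D (4 ℕ.+ m) X (2 ℕ.+ m)
  ≡⟨ column-⟦⟧-inside {D} X (antepenultimateD m) (cartanD-antepenultimate m) refl
       (ℕP.m≤n+m _ 2 ∷ ℕP.m≤n+m _ 3 ∷ ℕP.n≤1+n _ ∷ ℕP.≤-refl ∷ []) ⟩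
    + 2 * X (2 ℕ.+ m) + (-1ℤ * X (suc m) + (-1ℤ * X (3 ℕ.+ m) + (-1ℤ * X (4 ℕ.+ m) + + 0)))
  ≡⟨ cong₂ (λ x y → + 2 * x + (-1ℤ * y + (-1ℤ * X (3 ℕ.+ m) + (-1ℤ * X (4 ℕ.+ m) + + 0))))
       (coweightD-< m I ℕP.≤-refl) (coweightD-< m I (ℕP.n≤1+n _)) ⟩
    + 2 * (+ 2 * c₂) + (-1ℤ * (+ 2 * c₁) + (-1ℤ * X (3 ℕ.+ m) + (-1ℤ * X (4 ℕ.+ m) + + 0)))
  ≡⟨ cong₂ (λ x y → + 2 * (+ 2 * c₂) + (-1ℤ * (+ 2 * c₁) + (-1ℤ * x + (-1ℤ * y + + 0))))
       (coweightD-penultimate m I) (coweightD-last m I) ⟩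
    + 2 * (+ 2 * c₂) + (-1ℤ * (+ 2 * c₁) + (-1ℤ * (c₂ + + 2 * δ₃) + (-1ℤ * (c₂ + + 2 * δ₄) + + 0)))
  ≡⟨ regroup c₁ c₂ δ₃ δ₄ ⟩
    + 2 * (c₂ - c₁ - δ₃ - δ₄)
  ≡⟨ cong (λ x → + 2 * (x - δ₃ - δ₄)) telescope ⟩
    + 2 * (δ I (2 ℕ.+ m) + (δ₃ + δ₄) - δ₃ - δ₄)
  ≡⟨ cong (+ 2 *_) (cancel (δ I (2 ℕ.+ m)) δ₃ δ₄) ⟩
    + 2 * δ I (2 ℕ.+ m) ∎
  where
  open ≡-Reasoning
  X : ℕ → ℤ
  X = coweightD m I
  c₁ c₂ δ₃ δ₄ : ℤ
  c₁ = clamp I (suc m)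
  c₂ = clamp I (2 ℕ.+ m)
  δ₃ = δ I (3 ℕ.+ m)
  δ₄ = δ I (4 ℕ.+ m)
  telescope : c₂ - c₁ ≡ δ I (2 ℕ.+ m) + (δ₃ + δ₄)
  telescope = trans (clamp-step I (suc m)) (cong (λ x → δ I (2 ℕ.+ m) + x)
    (trans (clamp-step I (2 ℕ.+ m)) (cong (λ x → δ₃ + x) (clamp-step-last I (3 ℕ.+ m) I≤n))))
  regroup : ∀ a b d₃ d₄ →
    + 2 * (+ 2 * b) + (-1ℤ * (+ 2 * a) + (-1ℤ * (b + + 2 * d₃) + (-1ℤ * (b + + 2 * d₄) + + 0)))
      ≡ + 2 * (b - a - d₃ - d₄)
  regroup = solve-∀
  cancel : ∀ a b c → a + (b + c) - b - c ≡ a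
  cancel = solve-∀

⟪⟫-spin : ∀ m I p → coweightD m I p ≡ clamp I (2 ℕ.+ m) + + 2 * δ I p →
  ⟪ (+ 2 , p) ∷ (-1ℤ , 2 ℕ.+ m) ∷ [] ⟫ (coweightD m I) ≡ + 4 * δ I p
⟪⟫-spin m I p X-at-p = trans
  (cong₂ (λ x y → + 2 * x + (-1ℤ * y + + 0)) X-at-p (coweightD-< m I ℕP.≤-refl))
  (spin (clamp I (2 ℕ.+ m)) (δ I p))
  where
  spin : ∀ c d → + 2 * (c + + 2 * d) + (-1ℤ * (+ 2 * c) + + 0) ≡ + 4 * d
  spin = solve-∀

columnD-penultimate : ∀ m I → column D (4 ℕ.+ m) (coweightD m I) (3 ℕ.+ m) ≡ + 4 * δ I (3 ℕ.+ m)
columnD-penultimate m I = trans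
  (column-⟦⟧-inside {D} (coweightD m I) (penultimateD m) (cartanD-penultimate m) refl
    (ℕP.n≤1+n _ ∷ ℕP.m≤n+m _ 2 ∷ []))
  (⟪⟫-spin m I (3 ℕ.+ m) (coweightD-penultimate m I))

columnD-last : ∀ m I → column D (4 ℕ.+ m) (coweightD m I) (4 ℕ.+ m) ≡ + 4 * δ I (4 ℕ.+ m)
columnD-last m I = trans
  (column-⟦⟧-last {D} (coweightD m I) (lastD m) -1ℤ (cartanD-last m) refl (ℕP.≤-refl ∷ ℕP.m≤n+m _ 2 ∷ []))
  (⟪⟫-spin m I (4 ℕ.+ m) (coweightD-last m I))

isFundamentalCoweightD : ∀ m I → I ℕ.≤ 4 ℕ.+ m → IsFundamentalCoweight D (4 ℕ.+ m) I (coweightD m I)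
isFundamentalCoweightD m I I≤n k k<n with ℕP.m≤n⇒m<n∨m≡n k<n
... | inj₂ refl = 3 , columnD-last m I
... | inj₁ k+1<n with ℕP.m≤n⇒m<n∨m≡n (ℕ.s≤s⁻¹ k+1<n)
...   | inj₂ refl = 3 , columnD-penultimate m I
...   | inj₁ k+2<n with ℕP.m≤n⇒m<n∨m≡n (ℕ.s≤s⁻¹ k+2<n)
...     | inj₂ refl = 1 , columnD-antepenultimate m I I≤n
...     | inj₁ k+3<n = 1 , columnD-chain m I k (ℕ.s≤s⁻¹ (ℕ.s≤s⁻¹ k+3<n))

-- coeff · simpleRoot k unfolds to column t n X (suc (toℕ k)).
toFundamentalCoweight : ∀ {t n} (i : Fin n) X → IsFundamentalCoweight t n (suc (toℕ i)) X →
  FundamentalCoweight {t} {n} i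
toFundamentalCoweight {t} {n} i X isCoweight = record
  { coeff = λ j → X (suc (toℕ j))
  ; orthogonal = orthogonal
  ; positive = positive
  }
  where
  orthogonal : ∀ k → k ≢ i → column t n X (suc (toℕ k)) ≡ + 0
  orthogonal k k≢i with isCoweight (toℕ k) (FinP.toℕ<n k)
  ... | c , col≡cδ = trans col≡cδ
    (trans (cong (+ suc c *_) (δ-≢ (k≢i ∘′ FinP.toℕ-injective ∘′ ℕP.suc-injective)))
           (ℤP.*-zeroʳ (+ suc c)))

  positive : + 0 ℤ.< column t n X (suc (toℕ i))
  positive with isCoweight (toℕ i) (FinP.toℕ<n i)
  ... | c , col≡cδ = subst (+ 0 ℤ.<_)
    (sym (trans col≡cδ (trans (cong (+ suc c *_) (δ-refl (suc (toℕ i)))) (ℤP.*-identityʳ (+ suc c)))))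
    (ℤ.+<+ (s≤s z≤n))

classicalCoweight : ∀ t n → ValidRank t n → ∀ I → I ℕ.≤ n → ∃[ X ] IsFundamentalCoweight t n I X
classicalCoweight A n _ I I≤n = coweightA n I , isFundamentalCoweightA n I I≤n
classicalCoweight B (suc (suc m)) (s≤s (s≤s z≤n)) I I≤n = coweightB m I , isFundamentalCoweightB m I I≤n
classicalCoweight C (suc (suc m)) (s≤s (s≤s z≤n)) I I≤n = clamp I , isFundamentalCoweightC m I I≤n
classicalCoweight D (suc (suc (suc (suc m)))) (s≤s (s≤s (s≤s (s≤s z≤n)))) I I≤n =
  coweightD m I , isFundamentalCoweightD m I I≤n

fundamentalCoweight : ∀ t n → ValidRank t n → (i : Fin n) → FundamentalCoweight {t} {n} i
fundamentalCoweight t n valid i with classicalCoweight t n valid (suc (toℕ i)) (FinP.toℕ<n i)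
... | X , isCoweight = toFundamentalCoweight i X isCoweight

proposition4p2 : (t : CartanType) (n : ℕ) → ValidRank t n →
    (w : Word n) → StrongMinuscule t n w →
    (v : Word n) → ReducedExpr t n v w →
    (i : Fin n) → i ∈ v
proposition4p2 t n valid w strong v (_ , v≡w) i =
  strongMinuscule-support {w = w} (fundamentalCoweight t n valid i) strong v≡w
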